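{- For every integer $k\geq 1$, let $$P_k(x,q)=\sum_{n\geq k}\sum_{\pi\in P_{n,k}}x^nq^{\mathrm{sumelements}(\pi)}.$$ Then $$\frac{d}{dq}P_k(x,q)\Big|_{q=1}=\frac{x^{k}}{(1-x)(1-2x)\cdots (1-kx)}\sum_{a=1}^{k}\frac{a(a-1)}{2}+\frac{x^{k+1}}{(1-x)(1-2x)\cdots (1-kx)}\sum_{i=1}^{k-1}\frac{(k-i)i(i+1)}{2(1-ix)}.$$
   Context: A set partition of $[n]$ with exactly $k$ blocks is a collection $\{B_1,\dots,B_k\}$ of nonempty pairwise disjoint subsets with union $[n]$, indexed so that $\min B_1<\cdots<\min B_k$; $P_{n,k}$ is the set of such partitions. A partition is identified with its canonical sequential form $\pi=\pi_1\cdots\pi_n$, where $i\in B_{\pi_i}$. An entry $\pi_i$ is a record if $\pi_i>\pi_j$ for all $j<i$; the records are the first occurrences of $1,\dots,k$. For $a\in[k]$, $\mathrm{sumelements}_a(\pi)$ is the sum of all entries of $\pi$ at positions strictly before the record $a$, and $\mathrm{sumelements}(\pi)=\sum_{a=1}^{k}\mathrm{sumelements}_a(\pi)$. For example, $\mathrm{sumelements}(121132)=1+(1+2+1+1)=6$. Here $P_k(x,q)$ is regarded as a formal power series in $x$ with polynomial coefficients in $q$. -}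

module Defs where

open import Data.Bool using (Bool; true; false; _∧_)
open import Data.Nat as ℕ using (ℕ; zero; suc; _≡ᵇ_; _≤ᵇ_; _⊔_; _∸_)
open import Data.Integer as ℤ using (ℤ; +_)
open import Data.Rational as ℚ using (ℚ; _/_)
open import Data.List using (List; []; _∷_; map; concatMap; filter; foldr; takeWhile; upTo)
open import Data.Nat.ListAction using (sum)
open import Relation.Nullary.Decidable using (yes; no)
open import Relation.Nullary using (¬_)
open import Relation.Binary.PropositionalEquality using (_≡_)
open import Data.Bool using (T)
open import Data.Bool.Properties using (T?)

range1 : ℕ → List ℕ
range1 k = map suc (upTo k)

words : ℕ → ℕ → List (List ℕ)
words zero    k = [] ∷ []
words (suc n) k = concatMap (λ w → map (λ a → a ∷ w) (range1 k)) (words n k)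

canonAux : ℕ → ℕ → List ℕ → Bool
canonAux k m []       = m ≡ᵇ k
canonAux k m (x ∷ xs) = (1 ≤ᵇ x) ∧ (x ≤ᵇ suc m) ∧ canonAux k (m ⊔ x) xs

IsCanonical : ℕ → List ℕ → Set
IsCanonical k π = T (canonAux k 0 π)

-- P_{n,k}: canonical sequential forms of partitions of [n] with exactly k blocks
P : ℕ → ℕ → List (List ℕ)
P n k = filter (λ π → T? (canonAux k 0 π)) (words n k)

sumelementsAt : ℕ → List ℕ → ℕ
sumelementsAt a π = sum (takeWhile (λ x → ¬? (x ℕ.≟ a)) π)
  where open import Relation.Nullary.Decidable using (¬?)

sumelements : ℕ → List ℕ → ℕ
sumelements k π = sum (map (λ a → sumelementsAt a π) (range1 k))

-- Formal power series in x with rational coefficients (coefficient sequences)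

FPS : Set
FPS = ℕ → ℚ

sumℚ : List ℚ → ℚ
sumℚ = foldr ℚ._+_ ℚ.0ℚ

_⊕_ : FPS → FPS → FPS
(f ⊕ g) n = f n ℚ.+ g n

_⊛_ : FPS → FPS → FPS
(f ⊛ g) n = sumℚ (map (λ j → f j ℚ.* g (n ∸ j)) (upTo (suc n)))

_·_ : ℚ → FPS → FPS
(c · f) n = c ℚ.* f n

xpow : ℕ → FPS
xpow m n with m ℕ.≟ n
... | yes _ = ℚ.1ℚ
... | no  _ = ℚ.0ℚ

-- 1/(1 - r x) = Σ_n r^n x^n
inv1m : ℕ → FPS
inv1m r n = (+ (r ℕ.^ n)) / 1

invProd : ℕ → FPS
invProd zero    = xpow 0
invProd (suc k) = invProd k ⊛ inv1m (suc k)

-- coefficient of x^n in d/dq P_k(x,q) at q = 1: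
-- d/dq Σ_{π ∈ P_{n,k}} q^{sumelements π} |_{q=1} = Σ_{π ∈ P_{n,k}} sumelements π
dP1 : ℕ → FPS
dP1 k n = (+ sum (map (sumelements k) (P n k))) / 1

rhs : ℕ → FPS
rhs k =
  ((sumℚ (map (λ a → (+ (a ℕ.* (a ∸ 1))) / 2) (range1 k))) · (xpow k ⊛ invProd k))
  ⊕ ((xpow (suc k) ⊛ invProd k)
     ⊛ (λ n → sumℚ (map (λ i → ((+ ((k ∸ i) ℕ.* i ℕ.* (i ℕ.+ 1))) / 2) ℚ.* inv1m i n)
                         (range1 (k ∸ 1)))))

module Submission where

open import Algebra.Bundles using (CommutativeSemiring; CommutativeRing)
open import Data.Bool using (Bool; true; false; _∧_)
open import Data.Bool.Properties using (∧-zeroʳ)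
open import Data.Empty using (⊥-elim)
import Data.Integer as ℤ
import Data.Integer.Properties as ℤP
open import Data.List using (List; []; _∷_; map; foldr; applyUpTo; upTo; _++_; concatMap; filterᵇ)
open import Data.Nat as ℕ using (ℕ; zero; suc; _∸_; _≤_; _≤ᵇ_; z<s; s<s; s≤s)
import Data.Nat.Properties as ℕP
open import Data.Nat.ListAction using (sum)
open import Data.Nat.Tactic.RingSolver using (solve-∀)
open import Data.Product using (_,_)
open import Data.Rational as ℚ using (ℚ; _/_; 0ℚ; 1ℚ; fromℚᵘ)
import Data.Rational.Properties as ℚP
open import Data.Rational.Unnormalised as ℚᵘ using (mkℚᵘ; *≡*)
import Data.Rational.Unnormalised.Properties as ℚᵘP
open import Function using (_∘_; id)
open import Relation.Nullary using (yes; no)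
open import Relation.Nullary.Decidable using (dec-true; dec-false)
open import Relation.Binary.PropositionalEquality
  using (_≡_; _≢_; refl; sym; trans; cong; cong₂; subst; module ≡-Reasoning)

open import Defs

-- Read a canonical word from the left, keeping track of its current maximum m.  Each
-- entry adds its value to sumelementsₐ for every record a not yet reached, so the total
-- splits into the contribution of the records themselves, the same constant
-- Σᵣ r (k − r) = Σₐ a (a − 1) / 2 for every partition, and that of the non-records.
-- Conditioning on the first letter turns the number of canonical continuations and their
-- total weight into linear recurrences in the length.  They are solved by r-Stirling
-- numbers and their convolutions with (iⁿ), which are the coefficients of
-- x^k / ∏ⱼ (1 − j x) and of x^(k+1) / ((1 − i x) ∏ⱼ (1 − j x)).

module RangeSums {c ℓ} (R : CommutativeSemiring c ℓ) where

  open CommutativeSemiring R renaming (refl to ≈-refl; sym to ≈-sym; trans to ≈-trans)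
  open import Algebra.Properties.CommutativeSemigroup +-commutativeSemigroup using (interchange)

  -- Indexed by ℕ rather than Fin, so that index arithmetic stays in ℕ.
  ∑< : ℕ → (ℕ → Carrier) → Carrier
  ∑< zero    f = 0#
  ∑< (suc n) f = f 0 + ∑< n (f ∘ suc)

  infixl 10 ∑<
  syntax ∑< n (λ i → e) = ∑[ i < n ] e

  ∑-cong : ∀ n {f g : ℕ → Carrier} → (∀ i → i ℕ.< n → f i ≈ g i) → ∑< n f ≈ ∑< n g
  ∑-cong zero    f≈g = ≈-refl
  ∑-cong (suc n) f≈g = +-cong (f≈g 0 z<s) (∑-cong n (λ i i<n → f≈g (suc i) (s<s i<n)))

  ∑-zero : ∀ n → ∑[ i < n ] 0# ≈ 0#
  ∑-zero zero    = ≈-refl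
  ∑-zero (suc n) = ≈-trans (+-identityˡ _) (∑-zero n)

  ∑-distrib-+ : ∀ n (f g : ℕ → Carrier) → ∑[ i < n ] (f i + g i) ≈ ∑< n f + ∑< n g
  ∑-distrib-+ zero    f g = ≈-sym (+-identityˡ 0#)
  ∑-distrib-+ (suc n) f g = ≈-trans (+-congˡ (∑-distrib-+ n (f ∘ suc) (g ∘ suc))) (interchange _ _ _ _)

  *-distribˡ-∑ : ∀ n x (f : ℕ → Carrier) → x * ∑< n f ≈ ∑[ i < n ] (x * f i)
  *-distribˡ-∑ zero    x f = zeroʳ x
  *-distribˡ-∑ (suc n) x f = ≈-trans (distribˡ x _ _) (+-congˡ (*-distribˡ-∑ n x (f ∘ suc)))

  ∑-split : ∀ m l (f : ℕ → Carrier) → ∑< (m ℕ.+ l) f ≈ ∑< m f + ∑[ j < l ] f (m ℕ.+ j)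
  ∑-split zero    l f = ≈-sym (+-identityˡ _)
  ∑-split (suc m) l f = ≈-trans (+-congˡ (∑-split m l (f ∘ suc))) (≈-sym (+-assoc _ _ _))

  ∑-last : ∀ n (f : ℕ → Carrier) → ∑< (suc n) f ≈ ∑< n f + f n
  ∑-last zero    f = ≈-trans (+-identityʳ _) (≈-sym (+-identityˡ _))
  ∑-last (suc n) f = ≈-trans (+-congˡ (∑-last n (f ∘ suc))) (≈-sym (+-assoc _ _ _))

  ∑-tail : ∀ n (f : ℕ → Carrier) → f 0 ≈ 0# → ∑< n f ≈ ∑[ i < n ∸ 1 ] f (suc i)
  ∑-tail zero    f f0≈0 = ≈-refl
  ∑-tail (suc n) f f0≈0 = ≈-trans (+-congʳ f0≈0) (+-identityˡ _)

  sumOf : ∀ {a} {A : Set a} → (A → Carrier) → List A → Carrier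
  sumOf f xs = foldr _+_ 0# (map f xs)

  sumOf-cong : ∀ {a} {A : Set a} {f g : A → Carrier} xs → (∀ x → f x ≈ g x) → sumOf f xs ≈ sumOf g xs
  sumOf-cong []       f≈g = ≈-refl
  sumOf-cong (x ∷ xs) f≈g = +-cong (f≈g x) (sumOf-cong xs f≈g)

  sumOf-zero : ∀ {a} {A : Set a} (xs : List A) → sumOf (λ _ → 0#) xs ≈ 0#
  sumOf-zero []       = ≈-refl
  sumOf-zero (x ∷ xs) = ≈-trans (+-identityˡ _) (sumOf-zero xs)

  sumOf-map : ∀ {a b} {A : Set a} {B : Set b} (f : B → Carrier) (g : A → B) xs →
              sumOf f (map g xs) ≈ sumOf (f ∘ g) xs
  sumOf-map f g []       = ≈-refl
  sumOf-map f g (x ∷ xs) = +-congˡ (sumOf-map f g xs)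

  sumOf-++ : ∀ {a} {A : Set a} (f : A → Carrier) xs ys → sumOf f (xs ++ ys) ≈ sumOf f xs + sumOf f ys
  sumOf-++ f []       ys = ≈-sym (+-identityˡ _)
  sumOf-++ f (x ∷ xs) ys = ≈-trans (+-congˡ (sumOf-++ f xs ys)) (≈-sym (+-assoc _ _ _))

  sumOf-concatMap : ∀ {a b} {A : Set a} {B : Set b} (f : B → Carrier) (g : A → List B) xs →
                    sumOf f (concatMap g xs) ≈ sumOf (λ x → sumOf f (g x)) xs
  sumOf-concatMap f g []       = ≈-refl
  sumOf-concatMap f g (x ∷ xs) = ≈-trans (sumOf-++ f (g x) _) (+-congˡ (sumOf-concatMap f g xs))

  sumOf-distrib-+ : ∀ {a} {A : Set a} (f g : A → Carrier) xs →
                    sumOf (λ x → f x + g x) xs ≈ sumOf f xs + sumOf g xs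
  sumOf-distrib-+ f g []       = ≈-sym (+-identityˡ 0#)
  sumOf-distrib-+ f g (x ∷ xs) = ≈-trans (+-congˡ (sumOf-distrib-+ f g xs)) (interchange _ _ _ _)

  *-distribˡ-sumOf : ∀ {a} {A : Set a} y (f : A → Carrier) xs →
                     y * sumOf f xs ≈ sumOf (λ x → y * f x) xs
  *-distribˡ-sumOf y f []       = zeroʳ y
  *-distribˡ-sumOf y f (x ∷ xs) = ≈-trans (distribˡ y _ _) (+-congˡ (*-distribˡ-sumOf y f xs))

  ∑-sumOf-comm : ∀ {a} {A : Set a} n (h : A → ℕ → Carrier) xs →
                 ∑[ j < n ] sumOf (λ x → h x j) xs ≈ sumOf (λ x → ∑[ j < n ] h x j) xs
  ∑-sumOf-comm n h []       = ∑-zero n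
  ∑-sumOf-comm n h (x ∷ xs) = ≈-trans (∑-distrib-+ n (h x) _) (+-congˡ (∑-sumOf-comm n h xs))

  sumOf-applyUpTo : ∀ (f : ℕ → Carrier) g n → sumOf f (applyUpTo g n) ≈ ∑[ i < n ] f (g i)
  sumOf-applyUpTo f g zero    = ≈-refl
  sumOf-applyUpTo f g (suc n) = +-congˡ (sumOf-applyUpTo f (g ∘ suc) n)

  sumOf-range1 : ∀ (f : ℕ → Carrier) n → sumOf f (range1 n) ≈ ∑[ i < n ] f (suc i)
  sumOf-range1 f n = ≈-trans (sumOf-map f suc (upTo n)) (sumOf-applyUpTo (f ∘ suc) id n)

module Counting where

  open import Algebra.Properties.CommutativeSemigroup ℕP.*-commutativeSemigroup using (x∙yz≈y∙xz)
  open import Data.Nat using (_+_; _*_; _^_; _<_; _≤?_; _≟_)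
  open ℕP using (*-zeroʳ; +-identityʳ; *-distribʳ-+; *-distribˡ-+; *-identityʳ; +-assoc; +-suc;
                 m<n⇒m<1+n; n<1+n; <⇒≱; <⇒≤; <⇒≢; >⇒≢; ≤-refl; ≤-reflexive; ≤-trans; <-≤-trans;
                 n≤1+n; m≤m+n; m<m+n; m≤m⊔n; m≥n⇒m⊔n≡m; m≤n⇒m⊔n≡n; m+n∸m≡n)
  open RangeSums ℕP.+-*-commutativeSemiring

  ∑-const : ∀ n c → ∑[ i < n ] c ≡ n * c
  ∑-const zero    c = refl
  ∑-const (suc n) c = cong (c +_) (∑-const n c)

  tri : ℕ → ℕ
  tri m = ∑[ i < m ] suc i

  tri-suc : ∀ m → tri (suc m) ≡ tri m + suc m
  tri-suc m = ∑-last m suc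

  tri*2 : ∀ m → tri m * 2 ≡ m * suc m
  tri*2 zero    = refl
  tri*2 (suc m) = begin
    tri (suc m) * 2        ≡⟨ cong (_* 2) (tri-suc m) ⟩
    (tri m + suc m) * 2    ≡⟨ *-distribʳ-+ 2 (tri m) (suc m) ⟩
    tri m * 2 + suc m * 2  ≡⟨ cong (_+ suc m * 2) (tri*2 m) ⟩
    m * suc m + suc m * 2  ≡⟨ alg m ⟩
    suc m * suc (suc m)    ∎
    where
    open ≡-Reasoning
    alg : ∀ m → m * suc m + suc m * 2 ≡ suc m * suc (suc m)
    alg = solve-∀

  -- rStirling n m l is the r-Stirling number S_m(n + m, m + l): the number of restricted
  -- growth words of length n that, started from maximum m, end with maximum m + l.
  rStirling : ℕ → ℕ → ℕ → ℕ
  rStirling n       m zero    = m ^ n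
  rStirling zero    m (suc l) = 0
  rStirling (suc n) m (suc l) = m * rStirling n m (suc l) + rStirling n (suc m) l

  rStirling-below : ∀ {n l} m → n < l → rStirling n m l ≡ 0
  rStirling-below {zero}  {suc l} m _ = refl
  rStirling-below {suc n} {suc l} m (s<s n<l) =
    cong₂ _+_ (trans (cong (m *_) (rStirling-below m (m<n⇒m<1+n n<l))) (*-zeroʳ m))
              (rStirling-below (suc m) n<l)

  rStirling-diag : ∀ l m → rStirling l m l ≡ 1
  rStirling-diag zero    m = refl
  rStirling-diag (suc l) m =
    cong₂ _+_ (trans (cong (m *_) (rStirling-below m (n<1+n l))) (*-zeroʳ m)) (rStirling-diag l (suc m))

  rStirling-suc-last : ∀ n m l →
    rStirling (suc n) m (suc l) ≡ (m + suc l) * rStirling n m (suc l) + rStirling n m l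
  rStirling-suc-last zero m zero    = cong (_+ 1) (trans (*-zeroʳ m) (sym (*-zeroʳ (m + 1))))
  rStirling-suc-last zero m (suc l) = cong (_+ 0) (trans (*-zeroʳ m) (sym (*-zeroʳ (m + suc (suc l)))))
  rStirling-suc-last (suc n) m zero =
    trans (cong (λ a → m * a + suc m ^ suc n) (rStirling-suc-last n m zero))
          (alg m (rStirling n m 1) (m ^ n) (suc m ^ n))
    where
    alg : ∀ m a p q → m * ((m + 1) * a + p) + suc m * q ≡ (m + 1) * (m * a + q) + m * p
    alg = solve-∀
  rStirling-suc-last (suc n) m (suc l) =
    trans (cong₂ (λ a b → m * a + b) (rStirling-suc-last n m (suc l)) (rStirling-suc-last n (suc m) l))
          (alg m l (rStirling n m (suc (suc l))) (rStirling n m (suc l))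
                   (rStirling n (suc m) (suc l)) (rStirling n (suc m) l))
    where
    alg : ∀ m l a b c d → m * ((m + suc (suc l)) * a + b) + ((suc m + suc l) * c + d)
                        ≡ (m + suc (suc l)) * (m * a + c) + (m * b + d)
    alg = solve-∀

  -- The coefficient of xⁿ in x / (1 − i x) · Σₛ rStirling s m l xˢ.
  rStirlingConv : ℕ → ℕ → ℕ → ℕ → ℕ
  rStirlingConv i zero    m l = 0
  rStirlingConv i (suc n) m l = i * rStirlingConv i n m l + rStirling n m l

  rStirlingConv-suc : ∀ i n m l →
    rStirlingConv i (suc n) m (suc l) ≡ m * rStirlingConv i n m (suc l) + rStirlingConv i n (suc m) l
  rStirlingConv-suc i zero    m l = trans (cong (_+ 0) (*-zeroʳ i)) (sym (cong (_+ 0) (*-zeroʳ m)))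
  rStirlingConv-suc i (suc n) m l =
    trans (cong (λ a → i * a + rStirling (suc n) m (suc l)) (rStirlingConv-suc i n m l))
          (alg i m (rStirlingConv i n m (suc l)) (rStirlingConv i n (suc m) l)
                   (rStirling n m (suc l)) (rStirling n (suc m) l))
    where
    alg : ∀ i m a b c d → i * (m * a + b) + (m * c + d) ≡ m * (i * a + c) + (i * b + d)
    alg = solve-∀

  rStirlingConv-diag : ∀ m n l → rStirlingConv m n (suc m) l ≡ rStirling n m (suc l)
  rStirlingConv-diag m zero    l = refl
  rStirlingConv-diag m (suc n) l = cong (λ a → m * a + rStirling n (suc m) l) (rStirlingConv-diag m n l)

  -- Contribution of the records m + 1, …, m + l: record r adds r to sumelementsₐ of each
  -- later record a.
  recordWeight : ℕ → ℕ → ℕ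
  recordWeight l m = ∑[ t < l ] (m * t + tri t)

  recordWeight-suc : ∀ l m → recordWeight (suc l) m ≡ l * suc m + recordWeight l (suc m)
  recordWeight-suc l m = begin
    (m * 0 + tri 0) + ∑[ t < l ] (m * suc t + tri (suc t))
      ≡⟨ cong₂ _+_ (trans (+-identityʳ (m * 0)) (*-zeroʳ m)) (∑-cong l (λ t _ → peel t)) ⟩
    ∑[ t < l ] (suc m + (suc m * t + tri t))
      ≡⟨ ∑-distrib-+ l (λ _ → suc m) _ ⟩
    ∑[ t < l ] suc m + recordWeight l (suc m)
      ≡⟨ cong (_+ recordWeight l (suc m)) (∑-const l (suc m)) ⟩
    l * suc m + recordWeight l (suc m) ∎
    where
    open ≡-Reasoning
    alg : ∀ m t T → m * suc t + (T + suc t) ≡ suc m + (suc m * t + T)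
    alg = solve-∀
    peel : ∀ t → m * suc t + tri (suc t) ≡ suc m + (suc m * t + tri t)
    peel t = trans (cong (m * suc t +_) (tri-suc t)) (alg m t (tri t))

  𝟙 : Bool → ℕ
  𝟙 true  = 1
  𝟙 false = 0

  ≤ᵇ-true : ∀ {m n} → m ≤ n → (m ≤ᵇ n) ≡ true
  ≤ᵇ-true {m} {n} = dec-true (m ≤? n)

  ≤ᵇ-false : ∀ {m n} → n < m → (m ≤ᵇ n) ≡ false
  ≤ᵇ-false {m} {n} n<m = dec-false (m ≤? n) (<⇒≱ n<m)

  sumelementsAt-first : ∀ a w → sumelementsAt a (a ∷ w) ≡ 0
  sumelementsAt-first a w rewrite dec-true (a ≟ a) refl = refl

  sumelementsAt-other : ∀ {a b} w → a ≢ b → sumelementsAt b (a ∷ w) ≡ a + sumelementsAt b w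
  sumelementsAt-other {a} {b} w a≢b rewrite dec-false (a ≟ b) a≢b = refl

  sum-filterᵇ : ∀ {a} {A : Set a} (b : A → Bool) (f : A → ℕ) xs →
                sum (map f (filterᵇ b xs)) ≡ sumOf (λ x → 𝟙 (b x) * f x) xs
  sum-filterᵇ b f []       = refl
  sum-filterᵇ b f (x ∷ xs) with b x
  ... | true  = cong₂ _+_ (sym (+-identityʳ (f x))) (sum-filterᵇ b f xs)
  ... | false = sum-filterᵇ b f xs

  sumelementsAbove : ℕ → ℕ → List ℕ → ℕ
  sumelementsAbove m l w = ∑[ j < l ] sumelementsAt (suc (m + j)) w

  sumelementsAbove-[] : ∀ m l → sumelementsAbove m l [] ≡ 0
  sumelementsAbove-[] m l = ∑-zero l

  sumelementsAbove-keep : ∀ {a m} l w → a ≤ m →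
    sumelementsAbove m l (a ∷ w) ≡ l * a + sumelementsAbove m l w
  sumelementsAbove-keep {a} {m} l w a≤m = begin
    ∑[ j < l ] sumelementsAt (suc (m + j)) (a ∷ w)        ≡⟨ ∑-cong l (λ j _ → sumelementsAt-other w (a≢ j)) ⟩
    ∑[ j < l ] (a + sumelementsAt (suc (m + j)) w)        ≡⟨ ∑-distrib-+ l (λ _ → a) _ ⟩
    ∑[ j < l ] a + sumelementsAbove m l w                 ≡⟨ cong (_+ sumelementsAbove m l w) (∑-const l a) ⟩
    l * a + sumelementsAbove m l w                        ∎
    where
    open ≡-Reasoning
    a≢ : ∀ j → a ≢ suc (m + j)
    a≢ j = <⇒≢ (s≤s (≤-trans a≤m (m≤m+n m j)))

  sumelementsAbove-record : ∀ m l w →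
    sumelementsAbove m (suc l) (suc m ∷ w) ≡ l * suc m + sumelementsAbove (suc m) l w
  sumelementsAbove-record m l w = begin
    sumelementsAt (suc (m + 0)) (suc m ∷ w) + ∑[ j < l ] sumelementsAt (suc (m + suc j)) (suc m ∷ w)
      ≡⟨ cong₂ _+_ first (∑-cong l (λ j _ → later j)) ⟩
    0 + ∑[ j < l ] (suc m + sumelementsAt (suc (suc m + j)) w)
      ≡⟨ ∑-distrib-+ l (λ _ → suc m) _ ⟩
    ∑[ j < l ] suc m + sumelementsAbove (suc m) l w
      ≡⟨ cong (_+ sumelementsAbove (suc m) l w) (∑-const l (suc m)) ⟩
    l * suc m + sumelementsAbove (suc m) l w ∎
    where
    open ≡-Reasoning
    first : sumelementsAt (suc (m + 0)) (suc m ∷ w) ≡ 0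
    first = trans (cong (λ b → sumelementsAt (suc b) (suc m ∷ w)) (+-identityʳ m)) (sumelementsAt-first (suc m) w)
    later : ∀ j → sumelementsAt (suc (m + suc j)) (suc m ∷ w) ≡ suc m + sumelementsAt (suc (suc m + j)) w
    later j = trans (sumelementsAt-other w (<⇒≢ (s≤s (m<m+n m z<s))))
                    (cong (λ b → suc m + sumelementsAt (suc b) w) (+-suc m j))

  ∑-sumelementsAbove-keep : ∀ m l w →
    ∑[ i < m ] sumelementsAbove m l (suc i ∷ w) ≡ l * tri m + m * sumelementsAbove m l w
  ∑-sumelementsAbove-keep m l w = begin
    ∑[ i < m ] sumelementsAbove m l (suc i ∷ w)             ≡⟨ ∑-cong m (λ i i<m → sumelementsAbove-keep l w i<m) ⟩
    ∑[ i < m ] (l * suc i + sumelementsAbove m l w)         ≡⟨ ∑-distrib-+ m _ _ ⟩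
    ∑[ i < m ] (l * suc i) + ∑[ i < m ] sumelementsAbove m l w
      ≡⟨ cong₂ _+_ (sym (*-distribˡ-∑ m l suc)) (∑-const m _) ⟩
    l * tri m + m * sumelementsAbove m l w                  ∎
    where open ≡-Reasoning

  module Canonical (k : ℕ) where

    canon-keep : ∀ {i m} w → i < m → canonAux k m (suc i ∷ w) ≡ canonAux k m w
    canon-keep w i<m = cong₂ _∧_ (≤ᵇ-true (s≤s (<⇒≤ i<m))) (cong (λ m′ → canonAux k m′ w) (m≥n⇒m⊔n≡m i<m))

    canon-record : ∀ m w → canonAux k m (suc m ∷ w) ≡ canonAux k (suc m) w
    canon-record m w = cong₂ _∧_ (≤ᵇ-true (≤-refl {suc m})) (cong (λ m′ → canonAux k m′ w) (m≤n⇒m⊔n≡n (n≤1+n m)))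

    canon-skip : ∀ {i m} w → m < i → canonAux k m (suc i ∷ w) ≡ false
    canon-skip {i} {m} w m<i = cong (_∧ canonAux k (m ℕ.⊔ suc i) w) (≤ᵇ-false {suc i} {suc m} (s≤s m<i))

    canon-beyond : ∀ {m} w → k < m → canonAux k m w ≡ false
    canon-beyond {m} []      k<m = dec-false (m ≟ k) (>⇒≢ k<m)
    canon-beyond {m} (x ∷ w) k<m =
      trans (cong (λ b → (1 ≤ᵇ x) ∧ (x ≤ᵇ suc m) ∧ b) (canon-beyond w (<-≤-trans k<m (m≤m⊔n m x))))
            (trans (cong ((1 ≤ᵇ x) ∧_) (∧-zeroʳ (x ≤ᵇ suc m))) (∧-zeroʳ (1 ≤ᵇ x)))

    sumCanonical : ℕ → ℕ → (List ℕ → ℕ) → ℕ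
    sumCanonical n m X = sumOf (λ w → 𝟙 (canonAux k m w) * X w) (words n k)

    canonicalCount : ℕ → ℕ → ℕ
    canonicalCount n m = sumCanonical n m (λ _ → 1)

    sumCanonical-cong : ∀ n m {X Y : List ℕ → ℕ} → (∀ w → X w ≡ Y w) → sumCanonical n m X ≡ sumCanonical n m Y
    sumCanonical-cong n m X≡Y = sumOf-cong (words n k) (λ w → cong (𝟙 (canonAux k m w) *_) (X≡Y w))

    sumCanonical-+ : ∀ n m (X Y : List ℕ → ℕ) →
      sumCanonical n m (λ w → X w + Y w) ≡ sumCanonical n m X + sumCanonical n m Y
    sumCanonical-+ n m X Y = trans (sumOf-cong (words n k) (λ w → *-distribˡ-+ (𝟙 (canonAux k m w)) (X w) (Y w)))
                                   (sumOf-distrib-+ _ _ (words n k))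

    sumCanonical-* : ∀ n m a (X : List ℕ → ℕ) → sumCanonical n m (λ w → a * X w) ≡ a * sumCanonical n m X
    sumCanonical-* n m a X = trans (sumOf-cong (words n k) (λ w → x∙yz≈y∙xz (𝟙 (canonAux k m w)) a (X w)))
                                   (sym (*-distribˡ-sumOf a _ (words n k)))

    sumCanonical-const : ∀ n m a → sumCanonical n m (λ _ → a) ≡ a * canonicalCount n m
    sumCanonical-const n m a = trans (sumCanonical-cong n m (λ _ → sym (*-identityʳ a))) (sumCanonical-* n m a (λ _ → 1))

    sumCanonical-beyond : ∀ n {m} X → k < m → sumCanonical n m X ≡ 0
    sumCanonical-beyond n X k<m =
      trans (sumOf-cong (words n k) (λ w → cong (λ b → 𝟙 b * X w) (canon-beyond w k<m))) (sumOf-zero (words n k))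

    sumOf-words-suc : ∀ (h : List ℕ → ℕ) n →
      sumOf h (words (suc n) k) ≡ sumOf (λ w → ∑[ i < k ] h (suc i ∷ w)) (words n k)
    sumOf-words-suc h n = trans (sumOf-concatMap h _ (words n k))
      (sumOf-cong (words n k) (λ w → trans (sumOf-map h (_∷ w) (range1 k)) (sumOf-range1 (λ a → h (a ∷ w)) k)))

    ∑-letters : ∀ {m l} w → m + l ≡ k → (Y : ℕ → ℕ) →
      ∑[ i < k ] (𝟙 (canonAux k m (suc i ∷ w)) * Y i)
        ≡ 𝟙 (canonAux k m w) * ∑[ i < m ] Y i + 𝟙 (canonAux k (suc m) w) * Y m
    ∑-letters {m} {l} w eq Y = begin
      ∑[ i < k ] f i                           ≡⟨ cong (λ b → ∑< b f) (sym eq) ⟩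
      ∑[ i < m + l ] f i                       ≡⟨ ∑-split m l f ⟩
      ∑[ i < m ] f i + ∑[ j < l ] f (m + j)   ≡⟨ cong₂ _+_ kept (fresh l eq) ⟩
      𝟙 (canonAux k m w) * ∑[ i < m ] Y i + 𝟙 (canonAux k (suc m) w) * Y m ∎
      where
      open ≡-Reasoning
      f : ℕ → ℕ
      f i = 𝟙 (canonAux k m (suc i ∷ w)) * Y i
      kept : ∑[ i < m ] f i ≡ 𝟙 (canonAux k m w) * ∑[ i < m ] Y i
      kept = trans (∑-cong m (λ i i<m → cong (λ b → 𝟙 b * Y i) (canon-keep w i<m)))
                   (sym (*-distribˡ-∑ m (𝟙 (canonAux k m w)) Y))
      fresh : ∀ r → m + r ≡ k → ∑[ j < r ] f (m + j) ≡ 𝟙 (canonAux k (suc m) w) * Y m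
      fresh zero    m+0≡k = cong (λ b → 𝟙 b * Y m) (sym (canon-beyond w k<1+m))
        where k<1+m = ≤-reflexive (cong suc (trans (sym m+0≡k) (+-identityʳ m)))
      fresh (suc r) _     = begin
        f (m + 0) + ∑[ j < r ] f (m + suc j)
          ≡⟨ cong₂ _+_ (cong f (+-identityʳ m)) (trans (∑-cong r (λ j _ → skipped j)) (∑-zero r)) ⟩
        f m + 0
          ≡⟨ trans (+-identityʳ (f m)) (cong (λ b → 𝟙 b * Y m) (canon-record m w)) ⟩
        𝟙 (canonAux k (suc m) w) * Y m ∎
        where
        skipped : ∀ j → f (m + suc j) ≡ 0
        skipped j = cong (λ b → 𝟙 b * Y (m + suc j)) (canon-skip w (m<m+n m z<s))

    sumCanonical-suc : ∀ n {m l} (X : List ℕ → ℕ) → m + l ≡ k →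
      sumCanonical (suc n) m X
        ≡ sumCanonical n m (λ w → ∑[ i < m ] X (suc i ∷ w)) + sumCanonical n (suc m) (λ w → X (suc m ∷ w))
    sumCanonical-suc n {m} {l} X eq = begin
      sumCanonical (suc n) m X
        ≡⟨ sumOf-words-suc _ n ⟩
      sumOf (λ w → ∑[ i < k ] (𝟙 (canonAux k m (suc i ∷ w)) * X (suc i ∷ w))) (words n k)
        ≡⟨ sumOf-cong (words n k) (λ w → ∑-letters w eq (λ i → X (suc i ∷ w))) ⟩
      sumOf (λ w → 𝟙 (canonAux k m w) * ∑[ i < m ] X (suc i ∷ w) + 𝟙 (canonAux k (suc m) w) * X (suc m ∷ w)) (words n k)
        ≡⟨ sumOf-distrib-+ _ _ (words n k) ⟩
      sumCanonical n m (λ w → ∑[ i < m ] X (suc i ∷ w)) + sumCanonical n (suc m) (λ w → X (suc m ∷ w)) ∎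
      where open ≡-Reasoning

    canonicalCount-suc : ∀ n {m l} → m + l ≡ k →
      canonicalCount (suc n) m ≡ m * canonicalCount n m + canonicalCount n (suc m)
    canonicalCount-suc n {m} eq = trans (sumCanonical-suc n _ eq)
      (cong (_+ canonicalCount n (suc m))
            (trans (sumCanonical-cong n m (λ _ → ∑-const m 1)) (sumCanonical-* n m m (λ _ → 1))))

    canonicalCount-closed : ∀ n {m l} → m + l ≡ k → canonicalCount n m ≡ rStirling n m l
    canonicalCount-closed zero {m} {zero} eq =
      cong (λ b → 𝟙 b * 1 + 0) (dec-true (m ≟ k) (trans (sym (+-identityʳ m)) eq))
    canonicalCount-closed zero {m} {suc l} eq =
      cong (λ b → 𝟙 b * 1 + 0) (dec-false (m ≟ k) (<⇒≢ (subst (m <_) eq (m<m+n m z<s))))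
    canonicalCount-closed (suc n) {m} {zero} eq = begin
      canonicalCount (suc n) m
        ≡⟨ canonicalCount-suc n eq ⟩
      m * canonicalCount n m + canonicalCount n (suc m)
        ≡⟨ cong₂ _+_ (cong (m *_) (canonicalCount-closed n eq)) (sumCanonical-beyond n _ k<1+m) ⟩
      m * m ^ n + 0
        ≡⟨ +-identityʳ _ ⟩
      m ^ suc n ∎
      where
      open ≡-Reasoning
      k<1+m = ≤-reflexive (cong suc (trans (sym eq) (+-identityʳ m)))
    canonicalCount-closed (suc n) {m} {suc l} eq = trans (canonicalCount-suc n eq)
      (cong₂ (λ a b → m * a + b) (canonicalCount-closed n eq) (canonicalCount-closed n (trans (sym (+-suc m l)) eq)))

    -- A non-record read while the maximum is i takes each value 1, …, i and is counted
    -- by the k − i records still to come.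
    nonRecordWeight : ℕ → ℕ
    nonRecordWeight i = (k ∸ i) * tri i

    nonRecordSum : ℕ → ℕ → ℕ → ℕ
    nonRecordSum n m l = ∑[ t < l ] (nonRecordWeight (m + t) * rStirlingConv (m + t) n m l)

    nonRecordSum-zero : ∀ m l → nonRecordSum 0 m l ≡ 0
    nonRecordSum-zero m l = trans (∑-cong l (λ t _ → *-zeroʳ (nonRecordWeight (m + t)))) (∑-zero l)

    nonRecordSum-suc : ∀ n {m l} → m + suc l ≡ k →
      nonRecordSum (suc n) m (suc l)
        ≡ m * nonRecordSum n m (suc l) + suc l * tri m * rStirling n m (suc l) + nonRecordSum n (suc m) l
    nonRecordSum-suc n {m} {l} eq = begin
      nonRecordSum (suc n) m (suc l)
        ≡⟨ ∑-cong (suc l) (λ t _ → split t) ⟩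
      ∑[ t < suc l ] (m * a t + b t)
        ≡⟨ ∑-distrib-+ (suc l) (λ t → m * a t) b ⟩
      ∑[ t < suc l ] (m * a t) + (b 0 + ∑[ t < l ] b (suc t))
        ≡⟨ cong₂ _+_ (sym (*-distribˡ-∑ (suc l) m a)) (cong₂ _+_ diagonal (∑-cong l (λ t _ → shift t))) ⟩
      m * nonRecordSum n m (suc l) + (suc l * tri m * rStirling n m (suc l) + nonRecordSum n (suc m) l)
        ≡⟨ sym (+-assoc (m * nonRecordSum n m (suc l)) _ _) ⟩
      m * nonRecordSum n m (suc l) + suc l * tri m * rStirling n m (suc l) + nonRecordSum n (suc m) l ∎
      where
      open ≡-Reasoning
      w = nonRecordWeight
      a b : ℕ → ℕ
      a t = w (m + t) * rStirlingConv (m + t) n m (suc l)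
      b t = w (m + t) * rStirlingConv (m + t) n (suc m) l
      alg : ∀ w m x y → w * (m * x + y) ≡ m * (w * x) + w * y
      alg = solve-∀
      split : ∀ t → w (m + t) * rStirlingConv (m + t) (suc n) m (suc l) ≡ m * a t + b t
      split t = trans (cong (w (m + t) *_) (rStirlingConv-suc (m + t) n m l)) (alg (w (m + t)) m _ _)
      diagonal : b 0 ≡ suc l * tri m * rStirling n m (suc l)
      diagonal = begin
        b 0                                   ≡⟨ cong (λ i → w i * rStirlingConv i n (suc m) l) (+-identityʳ m) ⟩
        w m * rStirlingConv m n (suc m) l     ≡⟨ cong₂ (λ d r → d * tri m * r) k∸m≡1+l (rStirlingConv-diag m n l) ⟩
        suc l * tri m * rStirling n m (suc l) ∎
        where k∸m≡1+l = trans (cong (_∸ m) (sym eq)) (m+n∸m≡n m (suc l))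
      shift : ∀ t → b (suc t) ≡ w (suc m + t) * rStirlingConv (suc m + t) n (suc m) l
      shift t = cong (λ i → w i * rStirlingConv i n (suc m) l) (+-suc m t)

    weightAbove : ℕ → ℕ → ℕ → ℕ
    weightAbove n m l = sumCanonical n m (sumelementsAbove m l)

    weightAbove-suc : ∀ n {m l} → m + suc l ≡ k →
      weightAbove (suc n) m (suc l)
        ≡ suc l * tri m * canonicalCount n m + m * weightAbove n m (suc l)
          + (l * suc m * canonicalCount n (suc m) + weightAbove n (suc m) l)
    weightAbove-suc n {m} {l} eq = begin
      weightAbove (suc n) m (suc l)
        ≡⟨ sumCanonical-suc n _ eq ⟩
      sumCanonical n m (λ w → ∑[ i < m ] sumelementsAbove m (suc l) (suc i ∷ w))
        + sumCanonical n (suc m) (λ w → sumelementsAbove m (suc l) (suc m ∷ w))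
        ≡⟨ cong₂ _+_ (sumCanonical-cong n m (∑-sumelementsAbove-keep m (suc l)))
                     (sumCanonical-cong n (suc m) (sumelementsAbove-record m l)) ⟩
      sumCanonical n m (λ w → suc l * tri m + m * sumelementsAbove m (suc l) w)
        + sumCanonical n (suc m) (λ w → l * suc m + sumelementsAbove (suc m) l w)
        ≡⟨ cong₂ _+_ (trans (sumCanonical-+ n m (λ _ → suc l * tri m) (λ w → m * sumelementsAbove m (suc l) w))
                            (cong₂ _+_ (sumCanonical-const n m (suc l * tri m))
                                       (sumCanonical-* n m m (sumelementsAbove m (suc l)))))
                     (trans (sumCanonical-+ n (suc m) (λ _ → l * suc m) (sumelementsAbove (suc m) l))
                            (cong (_+ weightAbove n (suc m) l) (sumCanonical-const n (suc m) (l * suc m)))) ⟩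
      suc l * tri m * canonicalCount n m + m * weightAbove n m (suc l)
        + (l * suc m * canonicalCount n (suc m) + weightAbove n (suc m) l) ∎
      where open ≡-Reasoning

    weightAbove-closed : ∀ n {m l} → m + l ≡ k →
      weightAbove n m l ≡ recordWeight l m * rStirling n m l + nonRecordSum n m l
    weightAbove-closed n {m} {zero} eq = sumCanonical-const n m 0
    weightAbove-closed zero {m} {suc l} eq = begin
      weightAbove 0 m (suc l)    ≡⟨ sumCanonical-cong 0 m (λ _ → sumelementsAbove-[] m (suc l)) ⟩
      sumCanonical 0 m (λ _ → 0) ≡⟨ sumCanonical-const 0 m 0 ⟩
      0                          ≡⟨ sym (cong₂ _+_ (*-zeroʳ (recordWeight (suc l) m)) (nonRecordSum-zero m (suc l))) ⟩
      recordWeight (suc l) m * 0 + nonRecordSum 0 m (suc l) ∎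
      where open ≡-Reasoning
    weightAbove-closed (suc n) {m} {suc l} eq = begin
      weightAbove (suc n) m (suc l)
        ≡⟨ weightAbove-suc n eq ⟩
      d * canonicalCount n m + m * weightAbove n m (suc l)
        + (a * canonicalCount n (suc m) + weightAbove n (suc m) l)
        ≡⟨ cong₂ _+_ (cong₂ (λ c x → d * c + m * x) (canonicalCount-closed n eq) (weightAbove-closed n eq))
                     (cong₂ (λ c x → a * c + x) (canonicalCount-closed n eq′) (weightAbove-closed n eq′)) ⟩
      d * G + m * (R * G + S) + (a * G′ + (R′ * G′ + S′))
        ≡⟨ cong (λ r → d * G + m * (r * G + S) + (a * G′ + (R′ * G′ + S′))) (recordWeight-suc l m) ⟩
      d * G + m * ((a + R′) * G + S) + (a * G′ + (R′ * G′ + S′))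
        ≡⟨ alg d m a R′ G G′ S S′ ⟩
      (a + R′) * (m * G + G′) + (m * S + d * G + S′)
        ≡⟨ sym (cong₂ (λ r s → r * rStirling (suc n) m (suc l) + s) (recordWeight-suc l m) (nonRecordSum-suc n eq)) ⟩
      R * rStirling (suc n) m (suc l) + nonRecordSum (suc n) m (suc l) ∎
      where
      open ≡-Reasoning
      eq′ = trans (sym (+-suc m l)) eq
      d  = suc l * tri m
      a  = l * suc m
      G  = rStirling n m (suc l)
      G′ = rStirling n (suc m) l
      R  = recordWeight (suc l) m
      R′ = recordWeight l (suc m)
      S  = nonRecordSum n m (suc l)
      S′ = nonRecordSum n (suc m) l
      alg : ∀ d m a r g g′ s s′ → d * g + m * ((a + r) * g + s) + (a * g′ + (r * g′ + s′))
                                ≡ (a + r) * (m * g + g′) + (m * s + d * g + s′)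
      alg = solve-∀

    sum-sumelements-P : ∀ n → sum (map (sumelements k) (P n k)) ≡ weightAbove n 0 k
    sum-sumelements-P n = trans (sum-filterᵇ (canonAux k 0) (sumelements k) (words n k))
      (sumOf-cong (words n k) (λ w → cong (𝟙 (canonAux k 0 w) *_) (sumOf-range1 (λ a → sumelementsAt a w) k)))

module Series where

  open Counting
  open import Algebra.Properties.CommutativeSemigroup
    (CommutativeRing.*-commutativeSemigroup ℚP.+-*-commutativeRing) using (x∙yz≈y∙xz)
  open import Data.Rational using (_+_; _*_)
  module ℕ∑ = RangeSums ℕP.+-*-commutativeSemiring
  open RangeSums (CommutativeRing.commutativeSemiring ℚP.+-*-commutativeRing)

  ι : ℕ → ℚ
  ι n = ℤ.+ n / 1

  fromℚᵘ-homo-+ : ∀ p q → fromℚᵘ (p ℚᵘ.+ q) ≡ fromℚᵘ p + fromℚᵘ q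
  fromℚᵘ-homo-+ p q = ℚP.toℚᵘ-injective (ℚᵘP.≃-trans (ℚP.toℚᵘ-fromℚᵘ (p ℚᵘ.+ q))
    (ℚᵘP.≃-sym (ℚᵘP.≃-trans (ℚP.toℚᵘ-homo-+ (fromℚᵘ p) (fromℚᵘ q))
                            (ℚᵘP.+-cong (ℚP.toℚᵘ-fromℚᵘ p) (ℚP.toℚᵘ-fromℚᵘ q)))))

  fromℚᵘ-homo-* : ∀ p q → fromℚᵘ (p ℚᵘ.* q) ≡ fromℚᵘ p * fromℚᵘ q
  fromℚᵘ-homo-* p q = ℚP.toℚᵘ-injective (ℚᵘP.≃-trans (ℚP.toℚᵘ-fromℚᵘ (p ℚᵘ.* q))
    (ℚᵘP.≃-sym (ℚᵘP.≃-trans (ℚP.toℚᵘ-homo-* (fromℚᵘ p) (fromℚᵘ q))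
                            (ℚᵘP.*-cong (ℚP.toℚᵘ-fromℚᵘ p) (ℚP.toℚᵘ-fromℚᵘ q)))))

  ι-+ : ∀ a b → ι (a ℕ.+ b) ≡ ι a + ι b
  ι-+ a b = trans (ℚP.fromℚᵘ-cong {mkℚᵘ (ℤ.+ (a ℕ.+ b)) 0} {mkℚᵘ (ℤ.+ a) 0 ℚᵘ.+ mkℚᵘ (ℤ.+ b) 0} (*≡* e))
                  (fromℚᵘ-homo-+ (mkℚᵘ (ℤ.+ a) 0) (mkℚᵘ (ℤ.+ b) 0))
    where
    e : ℤ.+ (a ℕ.+ b) ℤ.* ℤ.1ℤ ≡ (ℤ.+ a ℤ.* ℤ.1ℤ ℤ.+ ℤ.+ b ℤ.* ℤ.1ℤ) ℤ.* ℤ.1ℤ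
    e = trans (ℤP.*-identityʳ _) (trans (ℤP.pos-+ a b)
          (sym (trans (ℤP.*-identityʳ _) (cong₂ ℤ._+_ (ℤP.*-identityʳ (ℤ.+ a)) (ℤP.*-identityʳ (ℤ.+ b))))))

  ι-* : ∀ a b → ι (a ℕ.* b) ≡ ι a * ι b
  ι-* a b = trans (ℚP.fromℚᵘ-cong {mkℚᵘ (ℤ.+ (a ℕ.* b)) 0} {mkℚᵘ (ℤ.+ a) 0 ℚᵘ.* mkℚᵘ (ℤ.+ b) 0}
                                  (*≡* (cong (ℤ._* ℤ.1ℤ) (ℤP.pos-* a b))))
                  (fromℚᵘ-homo-* (mkℚᵘ (ℤ.+ a) 0) (mkℚᵘ (ℤ.+ b) 0))

  ι-*-+ : ∀ a b c → ι (a ℕ.* b ℕ.+ c) ≡ ι a * ι b + ι c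
  ι-*-+ a b c = trans (ι-+ (a ℕ.* b) c) (cong (_+ ι c) (ι-* a b))

  ι-∑ : ∀ n f → ι (ℕ∑.∑< n f) ≡ ∑[ i < n ] ι (f i)
  ι-∑ zero    f = refl
  ι-∑ (suc n) f = trans (ι-+ (f 0) _) (cong (ι (f 0) +_) (ι-∑ n (f ∘ suc)))

  ι-half : ∀ {x} t → x ≡ t ℕ.* 2 → ℤ.+ x / 2 ≡ ι t
  ι-half {x} t x≡t*2 = ℚP.fromℚᵘ-cong {mkℚᵘ (ℤ.+ x) 1} {mkℚᵘ (ℤ.+ t) 0}
    (*≡* (trans (ℤP.*-identityʳ (ℤ.+ x)) (trans (cong ℤ.+_ x≡t*2) (ℤP.pos-* t 2))))

  ⊛-as-∑ : ∀ f g n → (f ⊛ g) n ≡ ∑[ j < suc n ] (f j * g (n ∸ j))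
  ⊛-as-∑ f g n = sumOf-applyUpTo (λ j → f j * g (n ∸ j)) id (suc n)

  ⊛-inv1m-zero : ∀ f r → (f ⊛ inv1m r) 0 ≡ f 0
  ⊛-inv1m-zero f r = trans (ℚP.+-identityʳ _) (ℚP.*-identityʳ (f 0))

  ⊛-inv1m-suc : ∀ f r n → (f ⊛ inv1m r) (suc n) ≡ f (suc n) + ι r * (f ⊛ inv1m r) n
  ⊛-inv1m-suc f r n = begin
    (f ⊛ inv1m r) (suc n)
      ≡⟨ ⊛-as-∑ f (inv1m r) (suc n) ⟩
    ∑[ j < suc (suc n) ] (f j * inv1m r (suc n ∸ j))
      ≡⟨ ∑-last (suc n) (λ j → f j * inv1m r (suc n ∸ j)) ⟩
    ∑[ j < suc n ] (f j * inv1m r (suc n ∸ j)) + f (suc n) * inv1m r (suc n ∸ suc n)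
      ≡⟨ cong₂ _+_ (∑-cong (suc n) earlier) last ⟩
    ∑[ j < suc n ] (ι r * (f j * inv1m r (n ∸ j))) + f (suc n)
      ≡⟨ cong (_+ f (suc n)) (sym (*-distribˡ-∑ (suc n) (ι r) (λ j → f j * inv1m r (n ∸ j)))) ⟩
    ι r * ∑[ j < suc n ] (f j * inv1m r (n ∸ j)) + f (suc n)
      ≡⟨ cong (λ x → ι r * x + f (suc n)) (sym (⊛-as-∑ f (inv1m r) n)) ⟩
    ι r * (f ⊛ inv1m r) n + f (suc n)
      ≡⟨ ℚP.+-comm (ι r * (f ⊛ inv1m r) n) (f (suc n)) ⟩
    f (suc n) + ι r * (f ⊛ inv1m r) n                          ∎
    where
    open ≡-Reasoning
    last : f (suc n) * inv1m r (suc n ∸ suc n) ≡ f (suc n)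
    last = trans (cong (λ d → f (suc n) * inv1m r d) (ℕP.n∸n≡0 n)) (ℚP.*-identityʳ (f (suc n)))
    earlier : ∀ j → j ℕ.< suc n → f j * inv1m r (suc n ∸ j) ≡ ι r * (f j * inv1m r (n ∸ j))
    earlier j (s≤s j≤n) = begin
      f j * ι (r ℕ.^ (suc n ∸ j))       ≡⟨ cong (λ d → f j * ι (r ℕ.^ d)) (ℕP.+-∸-assoc 1 j≤n) ⟩
      f j * ι (r ℕ.* r ℕ.^ (n ∸ j))     ≡⟨ cong (f j *_) (ι-* r _) ⟩
      f j * (ι r * inv1m r (n ∸ j))     ≡⟨ x∙yz≈y∙xz (f j) (ι r) _ ⟩
      ι r * (f j * inv1m r (n ∸ j))     ∎

  xpow-≡ : ∀ {m n} → m ≡ n → xpow m n ≡ 1ℚ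
  xpow-≡ {m} {n} m≡n with m ℕ.≟ n
  ... | yes _   = refl
  ... | no m≢n = ⊥-elim (m≢n m≡n)

  xpow-≢ : ∀ {m n} → m ≢ n → xpow m n ≡ 0ℚ
  xpow-≢ {m} {n} m≢n with m ℕ.≟ n
  ... | yes m≡n = ⊥-elim (m≢n m≡n)
  ... | no _    = refl

  xpow-suc : ∀ m n → xpow (suc m) (suc n) ≡ xpow m n
  xpow-suc m n with m ℕ.≟ n
  ... | yes m≡n = xpow-≡ (cong suc m≡n)
  ... | no m≢n  = xpow-≢ (m≢n ∘ ℕP.suc-injective)

  xpow-zero-⊛ : ∀ f n → (xpow 0 ⊛ f) n ≡ f n
  xpow-zero-⊛ f n = begin
    (xpow 0 ⊛ f) n
      ≡⟨ ⊛-as-∑ (xpow 0) f n ⟩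
    1ℚ * f n + ∑[ j < n ] (0ℚ * f (n ∸ suc j))
      ≡⟨ cong₂ _+_ (ℚP.*-identityˡ (f n)) (∑-cong n (λ j _ → ℚP.*-zeroˡ (f (n ∸ suc j)))) ⟩
    f n + ∑[ j < n ] 0ℚ
      ≡⟨ trans (cong (f n +_) (∑-zero n)) (ℚP.+-identityʳ (f n)) ⟩
    f n ∎
    where open ≡-Reasoning

  xpow-suc-⊛-zero : ∀ m f → (xpow (suc m) ⊛ f) 0 ≡ 0ℚ
  xpow-suc-⊛-zero m f = trans (ℚP.+-identityʳ _) (ℚP.*-zeroˡ (f 0))

  xpow-suc-⊛-suc : ∀ m f n → (xpow (suc m) ⊛ f) (suc n) ≡ (xpow m ⊛ f) n
  xpow-suc-⊛-suc m f n = begin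
    (xpow (suc m) ⊛ f) (suc n)
      ≡⟨ ⊛-as-∑ (xpow (suc m)) f (suc n) ⟩
    0ℚ * f (suc n) + ∑[ j < suc n ] (xpow (suc m) (suc j) * f (n ∸ j))
      ≡⟨ cong₂ _+_ (ℚP.*-zeroˡ (f (suc n))) (∑-cong (suc n) (λ j _ → cong (_* f (n ∸ j)) (xpow-suc m j))) ⟩
    0ℚ + ∑[ j < suc n ] (xpow m j * f (n ∸ j))
      ≡⟨ ℚP.+-identityˡ _ ⟩
    ∑[ j < suc n ] (xpow m j * f (n ∸ j))
      ≡⟨ sym (⊛-as-∑ (xpow m) f n) ⟩
    (xpow m ⊛ f) n ∎
    where open ≡-Reasoning

  xpow-⊛-shift : ∀ m f t → (xpow m ⊛ f) (m ℕ.+ t) ≡ f t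
  xpow-⊛-shift zero    f t = xpow-zero-⊛ f t
  xpow-⊛-shift (suc m) f t = trans (xpow-suc-⊛-suc m f (m ℕ.+ t)) (xpow-⊛-shift m f t)

  xpow-⊛-below : ∀ {m n} f → n ℕ.< m → (xpow m ⊛ f) n ≡ 0ℚ
  xpow-⊛-below {suc m} {zero}  f _         = xpow-suc-⊛-zero m f
  xpow-⊛-below {suc m} {suc n} f (s≤s n<m) = trans (xpow-suc-⊛-suc m f n) (xpow-⊛-below f n<m)

  invProd-closed : ∀ k t → invProd k t ≡ ι (rStirling (k ℕ.+ t) 0 k)
  invProd-closed zero    zero    = refl
  invProd-closed zero    (suc t) = refl
  invProd-closed (suc k) zero    = begin
    (invProd k ⊛ inv1m (suc k)) 0          ≡⟨ ⊛-inv1m-zero (invProd k) (suc k) ⟩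
    invProd k 0                            ≡⟨ invProd-closed k 0 ⟩
    ι (rStirling (k ℕ.+ 0) 0 k)            ≡⟨ cong ι (rStirling-diag-+0 k) ⟩
    1ℚ                                     ≡⟨ cong ι (sym (rStirling-diag-+0 (suc k))) ⟩
    ι (rStirling (suc k ℕ.+ 0) 0 (suc k))  ∎
    where
    open ≡-Reasoning
    rStirling-diag-+0 : ∀ l → rStirling (l ℕ.+ 0) 0 l ≡ 1
    rStirling-diag-+0 l = trans (cong (λ n → rStirling n 0 l) (ℕP.+-identityʳ l)) (rStirling-diag l 0)
  invProd-closed (suc k) (suc t) = begin
    (invProd k ⊛ inv1m (suc k)) (suc t)                 ≡⟨ ⊛-inv1m-suc (invProd k) (suc k) t ⟩
    invProd k (suc t) + ι (suc k) * invProd (suc k) t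
      ≡⟨ cong₂ (λ a b → a + ι (suc k) * b) (invProd-closed k (suc t)) (invProd-closed (suc k) t) ⟩
    ι (rStirling (k ℕ.+ suc t) 0 k) + ι (suc k) * ι S   ≡⟨ cong (λ n → ι (rStirling n 0 k) + ι (suc k) * ι S) (ℕP.+-suc k t) ⟩
    ι S′ + ι (suc k) * ι S                              ≡⟨ ℚP.+-comm (ι S′) (ι (suc k) * ι S) ⟩
    ι (suc k) * ι S + ι S′                              ≡⟨ sym (ι-*-+ (suc k) S S′) ⟩
    ι (suc k ℕ.* S ℕ.+ S′)                               ≡⟨ cong ι (sym (rStirling-suc-last (suc k ℕ.+ t) 0 k)) ⟩
    ι (rStirling (suc (suc k ℕ.+ t)) 0 (suc k))          ≡⟨ cong (λ n → ι (rStirling (suc n) 0 (suc k))) (sym (ℕP.+-suc k t)) ⟩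
    ι (rStirling (suc k ℕ.+ suc t) 0 (suc k))            ∎
    where
    open ≡-Reasoning
    S  = rStirling (suc k ℕ.+ t) 0 (suc k)
    S′ = rStirling (suc k ℕ.+ t) 0 k

  xpow-⊛-invProd : ∀ k n → (xpow k ⊛ invProd k) n ≡ ι (rStirling n 0 k)
  xpow-⊛-invProd k n with k ℕ.≤? n
  ... | yes k≤n with ℕP.m≤n⇒∃[o]m+o≡n k≤n
  ...   | t , refl = trans (xpow-⊛-shift k (invProd k) t) (invProd-closed k t)
  xpow-⊛-invProd k n | no k≰n =
    trans (xpow-⊛-below (invProd k) (ℕP.≰⇒> k≰n)) (cong ι (sym (rStirling-below 0 (ℕP.≰⇒> k≰n))))

  shifted-invProd-⊛-inv1m : ∀ k i n →
    ((xpow (suc k) ⊛ invProd k) ⊛ inv1m i) n ≡ ι (rStirlingConv i n 0 k)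
  shifted-invProd-⊛-inv1m k i zero    =
    trans (⊛-inv1m-zero (xpow (suc k) ⊛ invProd k) i) (xpow-suc-⊛-zero k (invProd k))
  shifted-invProd-⊛-inv1m k i (suc n) = begin
    ((xpow (suc k) ⊛ invProd k) ⊛ inv1m i) (suc n)
      ≡⟨ ⊛-inv1m-suc (xpow (suc k) ⊛ invProd k) i n ⟩
    (xpow (suc k) ⊛ invProd k) (suc n) + ι i * ((xpow (suc k) ⊛ invProd k) ⊛ inv1m i) n
      ≡⟨ cong₂ (λ a b → a + ι i * b) (trans (xpow-suc-⊛-suc k (invProd k) n) (xpow-⊛-invProd k n))
                                      (shifted-invProd-⊛-inv1m k i n) ⟩
    ι (rStirling n 0 k) + ι i * ι (rStirlingConv i n 0 k)
      ≡⟨ ℚP.+-comm (ι (rStirling n 0 k)) (ι i * ι (rStirlingConv i n 0 k)) ⟩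
    ι i * ι (rStirlingConv i n 0 k) + ι (rStirling n 0 k)
      ≡⟨ sym (ι-*-+ i (rStirlingConv i n 0 k) (rStirling n 0 k)) ⟩
    ι (rStirlingConv i (suc n) 0 k) ∎
    where open ≡-Reasoning

  ⊛-linear : ∀ (f : FPS) (c : ℕ → ℚ) (g : ℕ → FPS) xs n →
    (f ⊛ (λ t → sumℚ (map (λ i → c i * g i t) xs))) n ≡ sumℚ (map (λ i → c i * (f ⊛ g i) n) xs)
  ⊛-linear f c g xs n = begin
    (f ⊛ (λ t → sumOf (λ i → c i * g i t) xs)) n
      ≡⟨ ⊛-as-∑ f (λ t → sumOf (λ i → c i * g i t) xs) n ⟩
    ∑[ j < suc n ] (f j * sumOf (λ i → c i * g i (n ∸ j)) xs)
      ≡⟨ ∑-cong (suc n) (λ j _ → *-distribˡ-sumOf (f j) (λ i → c i * g i (n ∸ j)) xs) ⟩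
    ∑[ j < suc n ] sumOf (λ i → f j * (c i * g i (n ∸ j))) xs
      ≡⟨ ∑-sumOf-comm (suc n) (λ i j → f j * (c i * g i (n ∸ j))) xs ⟩
    sumOf (λ i → ∑[ j < suc n ] (f j * (c i * g i (n ∸ j)))) xs
      ≡⟨ sumOf-cong xs (λ i → trans (∑-cong (suc n) (λ j _ → x∙yz≈y∙xz (f j) (c i) (g i (n ∸ j))))
                                    (sym (*-distribˡ-∑ (suc n) (c i) (λ j → f j * g i (n ∸ j))))) ⟩
    sumOf (λ i → c i * ∑[ j < suc n ] (f j * g i (n ∸ j))) xs
      ≡⟨ sumOf-cong xs (λ i → cong (c i *_) (sym (⊛-as-∑ f (g i) n))) ⟩
    sumOf (λ i → c i * (f ⊛ g i) n) xs ∎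
    where open ≡-Reasoning

  module _ (k : ℕ) where
    open Canonical k

    ι-recordWeight : ι (recordWeight k 0) ≡ sumℚ (map (λ a → ℤ.+ (a ℕ.* (a ∸ 1)) / 2) (range1 k))
    ι-recordWeight = begin
      ι (recordWeight k 0)                 ≡⟨ ι-∑ k tri ⟩
      ∑[ t < k ] ι (tri t)                 ≡⟨ ∑-cong k (λ t _ → sym (ι-half (tri t) (suc*≡tri*2 t))) ⟩
      ∑[ t < k ] (ℤ.+ (suc t ℕ.* t) / 2)   ≡⟨ sym (sumOf-range1 (λ a → ℤ.+ (a ℕ.* (a ∸ 1)) / 2) k) ⟩
      sumℚ (map (λ a → ℤ.+ (a ℕ.* (a ∸ 1)) / 2) (range1 k)) ∎
      where
      open ≡-Reasoning
      suc*≡tri*2 : ∀ t → suc t ℕ.* t ≡ tri t ℕ.* 2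
      suc*≡tri*2 t = trans (ℕP.*-comm (suc t) t) (sym (tri*2 t))

    nonRecordCoefficient : ∀ i → ℤ.+ ((k ∸ i) ℕ.* i ℕ.* (i ℕ.+ 1)) / 2 ≡ ι (nonRecordWeight i)
    nonRecordCoefficient i = ι-half (nonRecordWeight i) (begin
      (k ∸ i) ℕ.* i ℕ.* (i ℕ.+ 1)  ≡⟨ alg₁ (k ∸ i) i ⟩
      (k ∸ i) ℕ.* (i ℕ.* suc i)    ≡⟨ cong ((k ∸ i) ℕ.*_) (sym (tri*2 i)) ⟩
      (k ∸ i) ℕ.* (tri i ℕ.* 2)    ≡⟨ sym (ℕP.*-assoc (k ∸ i) (tri i) 2) ⟩
      (k ∸ i) ℕ.* tri i ℕ.* 2      ∎)
      where
      open ≡-Reasoning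
      alg₁ : ∀ d i → d ℕ.* i ℕ.* (i ℕ.+ 1) ≡ d ℕ.* (i ℕ.* suc i)
      alg₁ = solve-∀

    ι-nonRecordSum : ∀ n → ι (nonRecordSum n 0 k)
      ≡ ((xpow (suc k) ⊛ invProd k)
         ⊛ (λ t → sumℚ (map (λ i → (ℤ.+ ((k ∸ i) ℕ.* i ℕ.* (i ℕ.+ 1)) / 2) * inv1m i t) (range1 (k ∸ 1))))) n
    ι-nonRecordSum n = begin
      ι (nonRecordSum n 0 k)
        ≡⟨ cong ι (ℕ∑.∑-tail k (λ t → nonRecordWeight t ℕ.* rStirlingConv t n 0 k)
                              (cong (ℕ._* rStirlingConv 0 n 0 k) (ℕP.*-zeroʳ k))) ⟩
      ι (ℕ∑.∑< (k ∸ 1) (λ t → nonRecordWeight (suc t) ℕ.* rStirlingConv (suc t) n 0 k))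
        ≡⟨ ι-∑ (k ∸ 1) _ ⟩
      ∑[ t < k ∸ 1 ] ι (nonRecordWeight (suc t) ℕ.* rStirlingConv (suc t) n 0 k)
        ≡⟨ ∑-cong (k ∸ 1) (λ t _ → term (suc t)) ⟩
      ∑[ t < k ∸ 1 ] (c (suc t) * (Y ⊛ inv1m (suc t)) n)
        ≡⟨ sym (sumOf-range1 (λ i → c i * (Y ⊛ inv1m i) n) (k ∸ 1)) ⟩
      sumℚ (map (λ i → c i * (Y ⊛ inv1m i) n) (range1 (k ∸ 1)))
        ≡⟨ sym (⊛-linear Y c inv1m (range1 (k ∸ 1)) n) ⟩
      (Y ⊛ (λ t → sumℚ (map (λ i → c i * inv1m i t) (range1 (k ∸ 1))))) n ∎
      where
      open ≡-Reasoning
      Y = xpow (suc k) ⊛ invProd k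
      c = λ i → ℤ.+ ((k ∸ i) ℕ.* i ℕ.* (i ℕ.+ 1)) / 2
      term : ∀ i → ι (nonRecordWeight i ℕ.* rStirlingConv i n 0 k) ≡ c i * (Y ⊛ inv1m i) n
      term i = trans (ι-* (nonRecordWeight i) (rStirlingConv i n 0 k))
                     (sym (cong₂ _*_ (nonRecordCoefficient i) (shifted-invProd-⊛-inv1m k i n)))

open Counting
open Series

-- The identity holds for k = 0 as well.
lemma1 : (k : ℕ) → 1 ≤ k → (n : ℕ) → dP1 k n ≡ rhs k n
lemma1 k _ n = begin
  dP1 k n                                                  ≡⟨ cong ι (sum-sumelements-P n) ⟩
  ι (weightAbove n 0 k)                                    ≡⟨ cong ι (weightAbove-closed n refl) ⟩
  ι (recordWeight k 0 ℕ.* rStirling n 0 k ℕ.+ nonRecordSum n 0 k)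
    ≡⟨ ι-*-+ (recordWeight k 0) (rStirling n 0 k) (nonRecordSum n 0 k) ⟩
  ι (recordWeight k 0) ℚ.* ι (rStirling n 0 k) ℚ.+ ι (nonRecordSum n 0 k)
    ≡⟨ cong₂ ℚ._+_ (cong₂ ℚ._*_ (ι-recordWeight k) (sym (xpow-⊛-invProd k n))) (ι-nonRecordSum k n) ⟩
  rhs k n                                                  ∎
  where
  open ≡-Reasoning
  open Canonical k
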